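{- Let $H$ be a $3$-uniform hypergraph with $7$ edges that contains no $1$-intersecting set of three edges. Then there is a $1$-intersecting set $S\subseteq E(H)$ such that the hypergraph $H\setminus S$ (edge set $E(H)\setminus S$) does not contain a copy of $T^3_6$.
   Context: A set of edges is $1$-intersecting if any two distinct edges in it share at most one vertex. $T^3_6$ is the $3$-uniform tight path with vertices $v_1,\ldots,v_6$ and edges $\{v_i,v_{i+1},v_{i+2}\}$, $1\le i\le4$. -}

module Defs where

open import Data.Nat using (ℕ; _≤_)
open import Data.Fin using (Fin; zero; suc; inject₁; _≟_)
open import Data.Fin.Subset using (Subset; _∈_; _∉_; _∩_; _∪_; ⁅_⁆; ∣_∣)
open import Data.Product using (Σ; ∃; _×_; _,_)
open import Relation.Binary.PropositionalEquality using (_≡_; _≢_)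
open import Function.Definitions using (Injective)

Edge3 : ℕ → Set
Edge3 n = Σ (Subset n) (λ e → ∣ e ∣ ≡ 3)

record Hypergraph3 (n m : ℕ) : Set where
  field
    edge     : Fin m → Subset n
    uniform  : ∀ i → ∣ edge i ∣ ≡ 3
    distinct : Injective _≡_ _≡_ edge
open Hypergraph3 public

OneIntersecting : ∀ {n m} → Hypergraph3 n m → Subset m → Set
OneIntersecting H S =
  ∀ i j → i ∈ S → j ∈ S → i ≢ j → ∣ edge H i ∩ edge H j ∣ ≤ 1

triple : ∀ {n} → Fin n → Fin n → Fin n → Subset n
triple a b c = ⁅ a ⁆ ∪ (⁅ b ⁆ ∪ ⁅ c ⁆)

-- The hypergraph H \ S (edges of H with index outside S) contains a copy of
-- the tight path T^3_6: six distinct vertices v₁..v₆ (v : Fin 6 → Fin n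
-- injective) such that each {v_t, v_{t+1}, v_{t+2}}, 1 ≤ t ≤ 4, is an edge
-- of H not in S.
IsEdgeOutside : ∀ {n m} → Hypergraph3 n m → Subset m → Subset n → Set
IsEdgeOutside H S e = ∃ λ i → i ∉ S × edge H i ≡ e

ContainsT36Outside : ∀ {n m} → Hypergraph3 n m → Subset m → Set
ContainsT36Outside {n} H S =
  Σ (Fin 6 → Fin n) λ v → Injective _≡_ _≡_ v ×
    ((t : Fin 4) →
      IsEdgeOutside H S
        (triple (v (inject₁ (inject₁ t))) (v (suc (inject₁ t))) (v (suc (suc t)))))

-- Only the sizes of pairwise intersections of edges matter, classified as 0, 1 or ≥ 2 (heavy).
-- The hypothesis says that among any three edges two overlap heavily, the four edges of a copy
-- of T³₆ show a fixed overlap pattern (`TightPath`), and a 1-intersecting set is one without a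
-- heavy pair.  So it suffices to find, for every admissible 7 × 7 overlap matrix, a set without
-- heavy pairs meeting every occurrence of the pattern.  If the pattern does not occur, the empty
-- set works.  Otherwise relabel the edges so that it occurs at 0, 1, 2, 3; the remaining entries
-- are handled by a computer-generated case split whose leaves are either contradictory or exhibit
-- such a set of at most two edges, and which is checked by evaluation.

module Submission where

open import Defs
open import Data.Bool using (Bool; true; false; T; not; _∧_; _∨_)
open import Data.Bool.ListAction using (any)
open import Data.Bool.Properties using (T-∧; T-∨)
open import Data.Empty using (⊥; ⊥-elim)
open import Data.Fin using (Fin; suc; inject₁; _≟_)
open import Data.Fin.Patterns using (0F; 1F; 2F; 3F; 4F; 5F; 6F)
open import Data.Fin.Permutation
  using (Permutation′; _⟨$⟩ʳ_; _⟨$⟩ˡ_; inverseʳ; inverseˡ; id; transpose; _∘ₚ_)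
open import Data.Fin.Properties using (any?)
open import Data.Fin.Subset using (Subset; _∈_; _∉_; _∩_; _∪_; _⊆_; ⁅_⁆; ∣_∣)
  renaming (⊥ to ∅)
open import Data.Fin.Subset.Properties
  using (_∈?_; _⊆?_; ∉⊥; ∣⊥∣≡0; ∣⁅x⁆∣≡1; x∈⁅x⁆; x∈⁅y⁆⇒x≡y; x∈p∪q⁺; x∈p∪q⁻; x∈p∩q⁺; x∈p∩q⁻;
         ∩-comm; ∩-idem; p⊆q⇒∣p∣≤∣q∣; x∈p⇒∣p-x∣<∣p∣; x∈p∧x≢y⇒x∈p-y)
open import Data.List using (allFin)
open import Data.List.Membership.Propositional using (lose)
open import Data.List.Membership.Propositional.Properties using (∈-allFin)
open import Data.List.Relation.Unary.Any.Properties using (any⁺)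
open import Data.Maybe using (Maybe; just; nothing)
open import Data.Maybe.Properties using (just-injective)
open import Data.Nat using (ℕ; zero; suc; _+_; _≤_; z≤n; s≤s)
open import Data.Nat.Properties using (≤-antisym; ≤-trans; n≤0⇒n≡0)
open import Data.Product using (Σ; ∃; ∃-syntax; _×_; _,_; proj₁; proj₂)
open import Data.Sum as Sum using (_⊎_; inj₁; inj₂)
open import Data.Unit using (tt)
open import Data.Vec using (Vec; tabulate; lookup; replicate; updateAt)
open import Data.Vec.Properties
  using (lookup∘tabulate; []=⇒lookup; lookup⇒[]=; lookup∘updateAt; lookup∘updateAt′; lookup-replicate)
open import Function.Base using (const; _∘_; case_of_)
open import Function.Bundles using (Equivalence)
open import Function.Definitions using (Injective)
open import Relation.Binary.Definitions using (DecidableEquality)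
open import Relation.Binary.PropositionalEquality
  using (_≡_; _≢_; refl; sym; trans; cong; cong₂; subst; subst₂; module ≡-Reasoning)
open import Relation.Nullary using (¬_; Dec; does; yes; no; contradiction)
open import Relation.Nullary.Decidable using (True; toWitness; map′; _×-dec_; dec-true; dec-false)

open ≡-Reasoning

data Overlap : Set where
  none one many : Overlap

infix 4 _≟ₒ_
_≟ₒ_ : DecidableEquality Overlap
none ≟ₒ none = yes refl
none ≟ₒ one  = no λ ()
none ≟ₒ many = no λ ()
one  ≟ₒ none = no λ ()
one  ≟ₒ one  = yes refl
one  ≟ₒ many = no λ ()
many ≟ₒ none = no λ ()
many ≟ₒ one  = no λ ()
many ≟ₒ many = yes refl

overlapOf : ℕ → Overlap
overlapOf zero          = none
overlapOf (suc zero)    = one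
overlapOf (suc (suc _)) = many

overlapOf≢many⇒≤1 : ∀ k → overlapOf k ≢ many → k ≤ 1
overlapOf≢many⇒≤1 zero          _     = z≤n
overlapOf≢many⇒≤1 (suc zero)    _     = s≤s z≤n
overlapOf≢many⇒≤1 (suc (suc _)) ≢many = contradiction refl ≢many

2≤⇒overlapOf≡many : ∀ {k} → 2 ≤ k → overlapOf k ≡ many
2≤⇒overlapOf≡many (s≤s (s≤s _)) = refl

OverlapMatrix : ℕ → Set
OverlapMatrix m = Fin m → Fin m → Overlap

module _ {m : ℕ} (M : OverlapMatrix m) where

  Light : Fin m → Fin m → Set
  Light i j = M i j ≢ many

  record TightPath (a b c d : Fin m) : Set where
    field
      ab : M a b ≡ many
      bc : M b c ≡ many
      cd : M c d ≡ many
      ac : M a c ≡ one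
      bd : M b d ≡ one
      ad : M a d ≡ none

  tightPath? : ∀ a b c d → Dec (TightPath a b c d)
  tightPath? a b c d =
    map′ (λ (p , q , r , s , t , u) → record { ab = p ; bc = q ; cd = r ; ac = s ; bd = t ; ad = u })
         (λ t → let open TightPath t in ab , bc , cd , ac , bd , ad)
         (M a b ≟ₒ many ×-dec M b c ≟ₒ many ×-dec M c d ≟ₒ many ×-dec
          M a c ≟ₒ one ×-dec M b d ≟ₒ one ×-dec M a d ≟ₒ none)

  record Admissible : Set where
    field
      symmetric         : ∀ i j → M i j ≡ M j i
      diagonal          : ∀ i → M i i ≡ many
      no-light-triangle : ∀ {i j k} → i ≢ j → j ≢ k → i ≢ k →
                          Light i j → Light j k → Light i k → ⊥

  record Transversal (S : Subset m) : Set where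
    field
      pairwise-light : ∀ {i j} → i ∈ S → j ∈ S → i ≢ j → Light i j
      meets          : ∀ {a b c d} → TightPath a b c d → a ∈ S ⊎ b ∈ S ⊎ c ∈ S ⊎ d ∈ S

module _ {m : ℕ} {M : OverlapMatrix m} where

  light-sym : (∀ i j → M i j ≡ M j i) → ∀ {i j} → Light M i j → Light M j i
  light-sym symmetric {i} {j} light Mji≡many = light (trans (symmetric i j) Mji≡many)

  light⇒≢ : Admissible M → ∀ {i j} → Light M i j → i ≢ j
  light⇒≢ adm light refl = light (Admissible.diagonal adm _)

  tightPath-consecutive-distinct : ∀ {a b c d} → TightPath M a b c d → a ≢ b × b ≢ c × c ≢ d
  tightPath-consecutive-distinct t =
    (λ { refl → one≢many (trans (sym ac) bc) }) ,
    (λ { refl → one≢many (trans (sym ac) ab) }) ,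
    (λ { refl → one≢many (trans (sym bd) bc) })
    where
      open TightPath t
      one≢many : one ≢ many
      one≢many ()

  tightPath-distinct : Admissible M → ∀ {a b c d} → TightPath M a b c d →
                       a ≢ b × a ≢ c × a ≢ d × b ≢ c × b ≢ d × c ≢ d
  tightPath-distinct adm t =
    a≢b , light⇒≢ adm (λ Mac≡many → case trans (sym ac) Mac≡many of λ ()) ,
    light⇒≢ adm (λ Mad≡many → case trans (sym ad) Mad≡many of λ ()) ,
    b≢c , light⇒≢ adm (λ Mbd≡many → case trans (sym bd) Mbd≡many of λ ()) , c≢d
    where
      open TightPath t
      a≢b = proj₁ (tightPath-consecutive-distinct t)
      b≢c = proj₁ (proj₂ (tightPath-consecutive-distinct t))
      c≢d = proj₂ (proj₂ (tightPath-consecutive-distinct t))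

  tightPath-cong : ∀ {a b c d a′ b′ c′ d′} → a ≡ a′ → b ≡ b′ → c ≡ c′ → d ≡ d′ →
                   TightPath M a b c d → TightPath M a′ b′ c′ d′
  tightPath-cong refl refl refl refl t = t

module _ {n : ℕ} where

  relabel : OverlapMatrix n → Permutation′ n → OverlapMatrix n
  relabel M π i j = M (π ⟨$⟩ʳ i) (π ⟨$⟩ʳ j)

  image : Permutation′ n → Subset n → Subset n
  image π S = tabulate λ x → lookup S (π ⟨$⟩ˡ x)

  ∈-image⁺ : ∀ π {S x} → π ⟨$⟩ˡ x ∈ S → x ∈ image π S
  ∈-image⁺ π {S} {x} x∈ = lookup⇒[]= x _ (trans (lookup∘tabulate _ x) ([]=⇒lookup x∈))

  ∈-image⁻ : ∀ π {S x} → x ∈ image π S → π ⟨$⟩ˡ x ∈ S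
  ∈-image⁻ π {S} {x} x∈ = lookup⇒[]= (π ⟨$⟩ˡ x) S (trans (sym (lookup∘tabulate _ x)) ([]=⇒lookup x∈))

  module _ {M : OverlapMatrix n} (π : Permutation′ n) where

    relabel-admissible : Admissible M → Admissible (relabel M π)
    relabel-admissible adm = record
      { symmetric         = λ i j → symmetric (π ⟨$⟩ʳ i) (π ⟨$⟩ʳ j)
      ; diagonal          = λ i → diagonal (π ⟨$⟩ʳ i)
      ; no-light-triangle = λ i≢j j≢k i≢k →
          no-light-triangle (π-respects-≢ i≢j) (π-respects-≢ j≢k) (π-respects-≢ i≢k)
      }
      where
        open Admissible adm
        π-respects-≢ : ∀ {i j} → i ≢ j → π ⟨$⟩ʳ i ≢ π ⟨$⟩ʳ j
        π-respects-≢ {i} {j} i≢j πi≡πj = i≢j (begin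
          i                 ≡⟨ inverseˡ π ⟨
          π ⟨$⟩ˡ (π ⟨$⟩ʳ i) ≡⟨ cong (π ⟨$⟩ˡ_) πi≡πj ⟩
          π ⟨$⟩ˡ (π ⟨$⟩ʳ j) ≡⟨ inverseˡ π ⟩
          j                 ∎)

    relabel-tightPath : ∀ {a b c d} → TightPath M (π ⟨$⟩ʳ a) (π ⟨$⟩ʳ b) (π ⟨$⟩ʳ c) (π ⟨$⟩ʳ d) →
                        TightPath (relabel M π) a b c d
    relabel-tightPath t = record { TightPath t }

    transversal-image : ∀ {S} → Transversal (relabel M π) S → Transversal M (image π S)
    transversal-image {S} T = record
      { pairwise-light = λ i∈ j∈ i≢j →
          subst₂ (Light M) (inverseʳ π) (inverseʳ π)
            (pairwise-light (∈-image⁻ π i∈) (∈-image⁻ π j∈) (i≢j ∘ π⁻¹-injective))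
      ; meets = λ t →
          Sum.map (∈-image⁺ π) (Sum.map (∈-image⁺ π) (Sum.map (∈-image⁺ π) (∈-image⁺ π)))
            (meets (relabel-tightPath (tightPath-cong π∘π⁻¹ π∘π⁻¹ π∘π⁻¹ π∘π⁻¹ t)))
      }
      where
        open Transversal T
        π∘π⁻¹ : ∀ {x} → x ≡ π ⟨$⟩ʳ (π ⟨$⟩ˡ x)
        π∘π⁻¹ = sym (inverseʳ π)
        π⁻¹-injective : ∀ {i j} → π ⟨$⟩ˡ i ≡ π ⟨$⟩ˡ j → i ≡ j
        π⁻¹-injective eq = trans π∘π⁻¹ (trans (cong (π ⟨$⟩ʳ_) eq) (sym π∘π⁻¹))

  opaque
    redirect : Permutation′ n → Fin n → Fin n → Permutation′ n
    redirect π k y = transpose k (π ⟨$⟩ˡ y) ∘ₚ π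

    redirect-target : ∀ π k y → redirect π k y ⟨$⟩ʳ k ≡ y
    redirect-target π k y rewrite dec-true (k ≟ k) refl = inverseʳ π

    redirect-others : ∀ π {k y i x} → π ⟨$⟩ʳ i ≡ x → i ≢ k → x ≢ y → redirect π k y ⟨$⟩ʳ i ≡ x
    redirect-others π {k} {y} {i} πi≡x i≢k x≢y
      rewrite dec-false (i ≟ k) i≢k
            | dec-false (i ≟ π ⟨$⟩ˡ y) λ { refl → x≢y (trans (sym πi≡x) (inverseʳ π)) } = πi≡x

placement : ∀ {n} (a b c d : Fin (4 + n)) →
            a ≢ b → a ≢ c → a ≢ d → b ≢ c → b ≢ d → c ≢ d →
            ∃[ π ] π ⟨$⟩ʳ 0F ≡ a × π ⟨$⟩ʳ 1F ≡ b × π ⟨$⟩ʳ 2F ≡ c × π ⟨$⟩ʳ 3F ≡ d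
placement {n} a b c d a≢b a≢c a≢d b≢c b≢d c≢d = π₄ , π₄0 , π₄1 , π₄2 , redirect-target π₃ 3F d
  where
    π₁ π₂ π₃ π₄ : Permutation′ (4 + n)
    π₁ = redirect id 0F a
    π₂ = redirect π₁ 1F b
    π₃ = redirect π₂ 2F c
    π₄ = redirect π₃ 3F d
    π₂0 : π₂ ⟨$⟩ʳ 0F ≡ a
    π₂0 = redirect-others π₁ (redirect-target id 0F a) (λ ()) a≢b
    π₃0 : π₃ ⟨$⟩ʳ 0F ≡ a
    π₃0 = redirect-others π₂ π₂0 (λ ()) a≢c
    π₃1 : π₃ ⟨$⟩ʳ 1F ≡ b
    π₃1 = redirect-others π₂ (redirect-target π₁ 1F b) (λ ()) b≢c
    π₄0 : π₄ ⟨$⟩ʳ 0F ≡ a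
    π₄0 = redirect-others π₃ π₃0 (λ ()) a≢d
    π₄1 : π₄ ⟨$⟩ʳ 1F ≡ b
    π₄1 = redirect-others π₃ π₃1 (λ ()) b≢d
    π₄2 : π₄ ⟨$⟩ʳ 2F ≡ c
    π₄2 = redirect-others π₃ (redirect-target π₂ 2F c) (λ ()) c≢d

anyFin : ∀ {n} → (Fin n → Bool) → Bool
anyFin f = any f (allFin _)

anyFin⁺ : ∀ {n} (f : Fin n → Bool) {i} → T (f i) → T (anyFin f)
anyFin⁺ f {i} fi = any⁺ f (lose (∈-allFin i) fi)

T-not⇒¬T : ∀ {b} → T (not b) → ¬ T b
T-not⇒¬T {false} _ ()

infixr 4 _,ᵀ_
_,ᵀ_ : ∀ {x y} → T x → T y → T (x ∧ y)
p ,ᵀ q = Equivalence.from T-∧ (p , q)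

∉⇒T-not-lookup : ∀ {n} {S : Subset n} {i} → i ∉ S → T (not (lookup S i))
∉⇒T-not-lookup {S = S} {i} i∉S with lookup S i in eq
... | true  = i∉S (lookup⇒[]= i S eq)
... | false = tt

≢⇒T-not-does : ∀ {n} {i j : Fin n} → i ≢ j → T (not (does (i ≟ j)))
≢⇒T-not-does {i = i} {j} i≢j rewrite dec-false (i ≟ j) i≢j = tt

∈-pair⁻ : ∀ {n} {x i j : Fin n} → x ∈ ⁅ i ⁆ ∪ ⁅ j ⁆ → x ≡ i ⊎ x ≡ j
∈-pair⁻ {i = i} {j} x∈ = Sum.map (x∈⁅y⁆⇒x≡y i) (x∈⁅y⁆⇒x≡y j) (x∈p∪q⁻ ⁅ i ⁆ ⁅ j ⁆ x∈)

-- A table rather than a function, so that evaluating the certificate computes each entry once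
-- per branch instead of once per lookup.
PartialMatrix : ℕ → Set
PartialMatrix m = Vec (Vec (Maybe Overlap) m) m

knownLight : Maybe Overlap → Bool
knownLight (just none) = true
knownLight (just one)  = true
knownLight _           = false

allows : Maybe Overlap → Overlap → Bool
allows nothing  _ = true
allows (just u) v = does (u ≟ₒ v)

module _ {m : ℕ} where

  entry : PartialMatrix m → Fin m → Fin m → Maybe Overlap
  entry P i j = lookup (lookup P i) j

  record Agrees (P : PartialMatrix m) (M : OverlapMatrix m) : Set where
    constructor agrees
    field
      known : ∀ {i j v} → entry P i j ≡ just v → M i j ≡ v

  setInRow : Fin m → Overlap → Vec (Maybe Overlap) m → Vec (Maybe Overlap) m
  setInRow j v row = updateAt row j (const (just v))

  diagonalRow : Fin m → Vec (Maybe Overlap) m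
  diagonalRow i = setInRow i many (replicate m nothing)

  onlyDiagonal : PartialMatrix m
  onlyDiagonal = tabulate diagonalRow

  set : PartialMatrix m → Fin m → Fin m → Overlap → PartialMatrix m
  set P i j v = updateAt P i (setInRow j v)

  infixl 5 _[_,_]≔_
  _[_,_]≔_ : PartialMatrix m → Fin m → Fin m → Overlap → PartialMatrix m
  P [ i , j ]≔ v = set (set P i j v) j i v

  tightPathKnowledge : Fin m → Fin m → Fin m → Fin m → PartialMatrix m
  tightPathKnowledge a b c d =
    onlyDiagonal [ a , b ]≔ many [ b , c ]≔ many [ c , d ]≔ many
                 [ a , c ]≔ one  [ b , d ]≔ one  [ a , d ]≔ none

  module _ {M : OverlapMatrix m} (adm : Admissible M) where
    open Admissible adm

    onlyDiagonal-agrees : Agrees onlyDiagonal M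
    onlyDiagonal-agrees = agrees known
      where
        known : ∀ {i j v} → entry onlyDiagonal i j ≡ just v → M i j ≡ v
        known {i} {j} {v} eq with j ≟ i
        ... | yes refl = trans (diagonal i) (just-injective (begin
          just many                      ≡⟨ lookup∘updateAt i (replicate m nothing) ⟨
          lookup (diagonalRow i) i       ≡⟨ cong (λ r → lookup r i) (lookup∘tabulate diagonalRow i) ⟨
          entry onlyDiagonal i i         ≡⟨ eq ⟩
          just v                         ∎))
        ... | no j≢i with () ← begin
          nothing                        ≡⟨ lookup-replicate j nothing ⟨
          lookup (replicate m nothing) j ≡⟨ lookup∘updateAt′ j i j≢i (replicate m nothing) ⟨
          lookup (diagonalRow i) j       ≡⟨ cong (λ r → lookup r j) (lookup∘tabulate diagonalRow i) ⟨
          entry onlyDiagonal i j         ≡⟨ eq ⟩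
          just v                         ∎

    set-agrees : ∀ {P i j v} → Agrees P M → M i j ≡ v → Agrees (set P i j v) M
    set-agrees {P} {i} {j} {v} ag Mij≡v = agrees known
      where
        known : ∀ {x y w} → entry (set P i j v) x y ≡ just w → M x y ≡ w
        known {x} {y} eq with x ≟ i
        ... | no x≢i =
          Agrees.known ag (trans (sym (cong (λ r → lookup r y) (lookup∘updateAt′ x i x≢i P))) eq)
        ... | yes refl with y ≟ j
        ...   | yes refl = trans Mij≡v (just-injective (begin
          just v                             ≡⟨ lookup∘updateAt y (lookup P x) ⟨
          lookup (setInRow y v (lookup P x)) y ≡⟨ cong (λ r → lookup r y) (lookup∘updateAt x P) ⟨
          entry (set P x y v) x y            ≡⟨ eq ⟩
          just _                             ∎))
        ...   | no y≢j = Agrees.known ag (begin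
          entry P x y                          ≡⟨ lookup∘updateAt′ y j y≢j (lookup P x) ⟨
          lookup (setInRow j v (lookup P x)) y ≡⟨ cong (λ r → lookup r y) (lookup∘updateAt x P) ⟨
          entry (set P x j v) x y              ≡⟨ eq ⟩
          just _                               ∎)

    update-agrees : ∀ {P i j v} → Agrees P M → M i j ≡ v → Agrees (P [ i , j ]≔ v) M
    update-agrees {i = i} {j} ag Mij≡v =
      set-agrees (set-agrees ag Mij≡v) (trans (symmetric j i) Mij≡v)

    tightPathKnowledge-agrees : ∀ {a b c d} → TightPath M a b c d →
                                Agrees (tightPathKnowledge a b c d) M
    tightPathKnowledge-agrees t =
      update-agrees (update-agrees (update-agrees (update-agrees (update-agrees (update-agrees
        onlyDiagonal-agrees ab) bc) cd) ac) bd) ad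
      where open TightPath t

  -- Tests for a ≢ c, a ≢ d and b ≢ d would be redundant: diagonal entries are known to be `many`.
  patternMayAvoid : PartialMatrix m → Subset m → Bool
  patternMayAvoid P S =
    anyFin λ a → not (lookup S a) ∧
    anyFin λ b → not (lookup S b) ∧ not (does (a ≟ b)) ∧ allows (entry P a b) many ∧
    anyFin λ c → not (lookup S c) ∧ not (does (b ≟ c)) ∧ allows (entry P b c) many ∧
                 allows (entry P a c) one ∧
    anyFin λ d → not (lookup S d) ∧ not (does (c ≟ d)) ∧ allows (entry P c d) many ∧
                 allows (entry P b d) one ∧ allows (entry P a d) none

  module _ {P : PartialMatrix m} {M : OverlapMatrix m} (ag : Agrees P M) where

    knownLight-sound : ∀ {i j} → T (knownLight (entry P i j)) → Light M i j
    knownLight-sound {i} {j} _ Mij≡many with entry P i j in eq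
    ... | just none with () ← trans (sym (Agrees.known ag eq)) Mij≡many
    ... | just one  with () ← trans (sym (Agrees.known ag eq)) Mij≡many

    allows-complete : ∀ {i j v} → M i j ≡ v → T (allows (entry P i j) v)
    allows-complete {i} {j} {v} Mij≡v with entry P i j in eq
    ... | nothing = tt
    ... | just u rewrite trans (sym (Agrees.known ag eq)) Mij≡v | dec-true (v ≟ₒ v) refl = tt

    tightPath⇒patternMayAvoid : ∀ {S a b c d} → TightPath M a b c d →
                                a ∉ S → b ∉ S → c ∉ S → d ∉ S → T (patternMayAvoid P S)
    tightPath⇒patternMayAvoid {a = a} {b} {c} {d} t a∉S b∉S c∉S d∉S =
      anyFin⁺ _ {a} (∉⇒T-not-lookup a∉S ,ᵀ
      anyFin⁺ _ {b} (∉⇒T-not-lookup b∉S ,ᵀ ≢⇒T-not-does a≢b ,ᵀ allows-complete ab ,ᵀ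
      anyFin⁺ _ {c} (∉⇒T-not-lookup c∉S ,ᵀ ≢⇒T-not-does b≢c ,ᵀ allows-complete bc ,ᵀ
                     allows-complete ac ,ᵀ
      anyFin⁺ _ {d} (∉⇒T-not-lookup d∉S ,ᵀ ≢⇒T-not-does c≢d ,ᵀ allows-complete cd ,ᵀ
                     allows-complete bd ,ᵀ allows-complete ad))))
      where
        open TightPath t
        a≢b = proj₁ (tightPath-consecutive-distinct t)
        b≢c = proj₁ (proj₂ (tightPath-consecutive-distinct t))
        c≢d = proj₂ (proj₂ (tightPath-consecutive-distinct t))

-- A leaf `✗ i j k` names a known
-- light triangle, which admissibility excludes; a leaf `✓ i j` claims that {i, j} (a singleton
-- when i = j) is a transversal of every completion.
data Certificate (m : ℕ) : Set where
  ✗     : Fin m → Fin m → Fin m → Certificate m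
  ✓     : Fin m → Fin m → Certificate m
  split : Fin m → Fin m → (t₀ t₁ t₂ : Certificate m) → Certificate m

module _ {m : ℕ} where

  valid : PartialMatrix m → Certificate m → Bool
  valid P (✗ i j k) = knownLight (entry P i j) ∧ knownLight (entry P j k) ∧ knownLight (entry P i k)
  valid P (✓ i j) =
    (does (i ≟ j) ∨ knownLight (entry P i j)) ∧ not (patternMayAvoid P (⁅ i ⁆ ∪ ⁅ j ⁆))
  valid P (split i j t₀ t₁ t₂) =
    valid (P [ i , j ]≔ none) t₀ ∧ valid (P [ i , j ]≔ one) t₁ ∧ valid (P [ i , j ]≔ many) t₂

  module _ {M : OverlapMatrix m} (adm : Admissible M) where
    open Admissible adm

    valid⇒transversal : ∀ {P} → Agrees P M → ∀ t → T (valid P t) → ∃ (Transversal M)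
    valid⇒transversal ag (✗ i j k) h
      with ij , h ← Equivalence.to T-∧ h
      with jk , ik ← Equivalence.to T-∧ h
      = ⊥-elim (no-light-triangle (light⇒≢ adm Lij) (light⇒≢ adm Ljk) (light⇒≢ adm Lik) Lij Ljk Lik)
      where
        Lij = knownLight-sound ag ij
        Ljk = knownLight-sound ag jk
        Lik = knownLight-sound ag ik
    valid⇒transversal {P} ag (✓ i j) h
      with lightPair , noAvoidingPattern ← Equivalence.to T-∧ h
      = S , record { pairwise-light = pairwise-light ; meets = meets }
      where
        S = ⁅ i ⁆ ∪ ⁅ j ⁆
        i≢j⇒Lij : i ≢ j → Light M i j
        i≢j⇒Lij i≢j with Equivalence.to T-∨ lightPair
        ... | inj₁ i≡j = contradiction i≡j (T-not⇒¬T (≢⇒T-not-does i≢j))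
        ... | inj₂ Lij = knownLight-sound ag Lij
        pairwise-light : ∀ {x y} → x ∈ S → y ∈ S → x ≢ y → Light M x y
        pairwise-light x∈S y∈S x≢y with ∈-pair⁻ x∈S | ∈-pair⁻ y∈S
        ... | inj₁ refl | inj₁ refl = contradiction refl x≢y
        ... | inj₁ refl | inj₂ refl = i≢j⇒Lij x≢y
        ... | inj₂ refl | inj₁ refl = light-sym symmetric (i≢j⇒Lij (x≢y ∘ sym))
        ... | inj₂ refl | inj₂ refl = contradiction refl x≢y
        meets : ∀ {a b c d} → TightPath M a b c d → a ∈ S ⊎ b ∈ S ⊎ c ∈ S ⊎ d ∈ S
        meets {a} {b} {c} {d} t with a ∈? S | b ∈? S | c ∈? S | d ∈? S
        ... | yes a∈S | _       | _       | _       = inj₁ a∈S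
        ... | no _    | yes b∈S | _       | _       = inj₂ (inj₁ b∈S)
        ... | no _    | no _    | yes c∈S | _       = inj₂ (inj₂ (inj₁ c∈S))
        ... | no _    | no _    | no _    | yes d∈S = inj₂ (inj₂ (inj₂ d∈S))
        ... | no a∉S  | no b∉S  | no c∉S  | no d∉S  =
          contradiction (tightPath⇒patternMayAvoid ag t a∉S b∉S c∉S d∉S)
                        (T-not⇒¬T noAvoidingPattern)
    valid⇒transversal {P} ag (split i j t₀ t₁ t₂) h
      with h₀ , h ← Equivalence.to T-∧ h
      with h₁ , h₂ ← Equivalence.to T-∧ h
      with M i j in Mij
    ... | none = valid⇒transversal (update-agrees adm ag Mij) t₀ h₀
    ... | one  = valid⇒transversal (update-agrees adm ag Mij) t₁ h₁
    ... | many = valid⇒transversal (update-agrees adm ag Mij) t₂ h₂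

-- Found by a computer search that splits on the entries left open by the pattern at 0, 1, 2, 3.
certificate : Certificate 7
certificate =
  split 0F 4F (split 2F 4F (✗ 0F 2F 4F) (✗ 0F 2F 4F) (split 3F 4F (✗ 0F 3F 4F) (✗ 0F 3F 4F) (split
  0F 5F (split 1F 6F (✓ 1F 6F) (✓ 0F 5F) (split 2F 5F (✗ 0F 2F 5F) (✗ 0F 2F 5F) (split 3F 5F (✗ 0F
  3F 5F) (✗ 0F 3F 5F) (split 4F 5F (✗ 0F 4F 5F) (✗ 0F 4F 5F) (split 0F 6F (✓ 1F 1F) (✓ 1F 1F)
  (split 2F 6F (✓ 1F 1F) (✓ 1F 1F) (split 4F 6F (✓ 0F 5F) (split 1F 5F (✓ 0F 3F) (✓ 0F 4F) (✓ 0F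
  3F)) (✓ 0F 5F)))))))) (split 1F 6F (✓ 1F 6F) (✓ 0F 5F) (split 2F 5F (✗ 0F 2F 5F) (✗ 0F 2F 5F)
  (split 3F 5F (✗ 0F 3F 5F) (✗ 0F 3F 5F) (split 4F 5F (✗ 0F 4F 5F) (✗ 0F 4F 5F) (split 0F 6F (✓ 1F
  1F) (✓ 1F 1F) (split 4F 6F (✓ 1F 3F) (split 1F 5F (✓ 0F 3F) (split 2F 6F (✓ 0F 4F) (✓ 1F 5F) (✓
  0F 4F)) (✓ 0F 3F)) (✓ 1F 3F))))))) (split 0F 6F (split 1F 5F (✓ 1F 5F) (✓ 0F 6F) (split 2F 6F (✗
  0F 2F 6F) (✗ 0F 2F 6F) (split 3F 6F (✗ 0F 3F 6F) (✗ 0F 3F 6F) (split 4F 6F (✗ 0F 4F 6F) (✗ 0F 4F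
  6F) (split 2F 5F (✓ 1F 1F) (✓ 1F 1F) (split 4F 5F (✓ 0F 6F) (split 1F 6F (✓ 0F 3F) (✓ 0F 4F) (✓
  0F 3F)) (✓ 0F 6F))))))) (split 1F 5F (✓ 1F 5F) (✓ 0F 6F) (split 2F 6F (✗ 0F 2F 6F) (✗ 0F 2F 6F)
  (split 3F 6F (✗ 0F 3F 6F) (✗ 0F 3F 6F) (split 4F 6F (✗ 0F 4F 6F) (✗ 0F 4F 6F) (split 4F 5F (✓ 1F
  3F) (split 1F 6F (✓ 0F 3F) (split 2F 5F (✓ 0F 4F) (✓ 1F 6F) (✓ 0F 4F)) (✓ 0F 3F)) (✓ 1F 3F))))))
  (split 1F 4F (split 5F 6F (split 2F 5F (✓ 0F 3F) (split 3F 6F (✓ 1F 4F) (✓ 2F 5F) (✓ 1F 4F))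
  (split 2F 6F (✓ 0F 3F) (split 3F 5F (✓ 1F 4F) (✓ 2F 6F) (✓ 1F 4F)) (✓ 0F 3F))) (✓ 0F 3F) (split
  1F 5F (split 2F 6F (✓ 1F 5F) (✓ 1F 5F) (split 2F 5F (✓ 0F 3F) (split 3F 6F (✓ 1F 4F) (✓ 2F 5F)
  (✓ 1F 4F)) (✓ 0F 3F))) (split 2F 6F (✓ 1F 5F) (✓ 1F 5F) (split 3F 5F (✗ 1F 3F 5F) (✗ 1F 3F 5F)
  (✓ 0F 4F))) (split 1F 6F (split 2F 5F (✓ 1F 6F) (✓ 1F 6F) (split 4F 6F (✗ 1F 4F 6F) (✗ 1F 4F 6F)
  (✓ 0F 3F))) (split 2F 5F (✓ 1F 6F) (✓ 1F 6F) (split 3F 6F (✗ 1F 3F 6F) (✗ 1F 3F 6F) (✓ 0F 4F)))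
  (split 2F 5F (split 4F 6F (✓ 3F 3F) (✓ 0F 3F) (✓ 2F 5F)) (split 3F 6F (✓ 1F 4F) (✓ 2F 5F) (✓ 1F
  4F)) (split 2F 6F (✓ 0F 3F) (split 3F 5F (✓ 1F 4F) (✓ 2F 6F) (✓ 1F 4F)) (✓ 0F 3F)))))) (split 2F
  5F (✓ 2F 5F) (✓ 2F 5F) (split 2F 6F (✓ 2F 6F) (✓ 2F 6F) (split 5F 6F (✓ 0F 3F) (split 1F 5F
  (split 1F 6F (✗ 1F 5F 6F) (✗ 1F 5F 6F) (split 3F 5F (✗ 1F 3F 5F) (✗ 1F 3F 5F) (split 3F 6F (✓ 0F
  4F) (✓ 0F 4F) (✓ 1F 4F)))) (✓ 0F 0F) (split 1F 6F (split 3F 5F (✓ 0F 4F) (✓ 0F 4F) (split 3F 6F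
  (✗ 1F 3F 6F) (✗ 1F 3F 6F) (✓ 1F 4F))) (✓ 0F 0F) (split 3F 5F (split 3F 6F (✗ 3F 5F 6F) (✗ 3F 5F
  6F) (✓ 1F 4F)) (✓ 0F 4F) (split 3F 6F (✓ 1F 4F) (✓ 0F 4F) (✓ 0F 4F))))) (✓ 0F 3F)))) (split 5F
  6F (split 1F 5F (split 1F 6F (✗ 1F 5F 6F) (✗ 1F 5F 6F) (split 2F 6F (✓ 0F 3F) (✓ 1F 5F) (split
  2F 5F (✓ 0F 3F) (split 3F 6F (✓ 3F 6F) (✓ 2F 5F) (✓ 2F 5F)) (✓ 0F 3F)))) (split 1F 6F (✗ 1F 5F
  6F) (✗ 1F 5F 6F) (split 2F 6F (✓ 0F 4F) (✓ 1F 5F) (split 2F 5F (✓ 0F 4F) (split 3F 6F (✓ 0F 4F)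
  (✓ 2F 5F) (✓ 0F 4F)) (✓ 0F 4F)))) (split 1F 6F (split 2F 5F (✓ 0F 3F) (✓ 1F 6F) (split 2F 6F (✓
  0F 3F) (split 3F 5F (✓ 3F 5F) (✓ 2F 6F) (✓ 2F 6F)) (✓ 0F 3F))) (split 2F 5F (✓ 0F 4F) (✓ 1F 6F)
  (split 2F 6F (✓ 0F 4F) (split 3F 5F (✓ 0F 4F) (✓ 2F 6F) (✓ 0F 4F)) (✓ 0F 4F))) (split 2F 5F (✓
  0F 3F) (split 3F 6F (✓ 3F 6F) (✓ 2F 5F) (✓ 2F 5F)) (split 2F 6F (✓ 0F 3F) (split 3F 5F (✓ 3F 5F)
  (✓ 2F 6F) (✓ 2F 6F)) (✓ 0F 3F))))) (✓ 0F 3F) (split 1F 5F (split 2F 6F (✓ 1F 5F) (✓ 1F 5F)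
  (split 2F 5F (✓ 0F 4F) (split 1F 6F (✓ 1F 6F) (✓ 1F 6F) (split 3F 6F (✓ 3F 6F) (✓ 2F 5F) (✓ 2F
  5F))) (✓ 0F 4F))) (split 2F 6F (✓ 1F 5F) (✓ 1F 5F) (split 3F 5F (✗ 1F 3F 5F) (✗ 1F 3F 5F) (✓ 0F
  4F))) (split 1F 6F (split 2F 5F (✓ 1F 6F) (✓ 1F 6F) (split 2F 6F (✓ 0F 3F) (split 3F 5F (✓ 3F
  5F) (✓ 2F 6F) (✓ 2F 6F)) (✓ 0F 3F))) (split 2F 5F (✓ 1F 6F) (✓ 1F 6F) (split 3F 6F (✗ 1F 3F 6F)
  (✗ 1F 3F 6F) (✓ 0F 4F))) (split 2F 5F (split 3F 6F (✓ 3F 6F) (✓ 0F 4F) (✓ 2F 5F)) (split 3F 6F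
  (✓ 3F 6F) (✓ 2F 5F) (✓ 2F 5F)) (split 2F 6F (✓ 0F 3F) (split 3F 5F (✓ 3F 5F) (✓ 2F 6F) (✓ 2F
  6F)) (✓ 0F 3F))))))))))) (split 2F 4F (✗ 0F 2F 4F) (✗ 0F 2F 4F) (split 3F 4F (✗ 0F 3F 4F) (✗ 0F
  3F 4F) (split 0F 5F (split 1F 6F (✓ 1F 6F) (✓ 0F 5F) (split 2F 5F (✗ 0F 2F 5F) (✗ 0F 2F 5F)
  (split 3F 5F (✗ 0F 3F 5F) (✗ 0F 3F 5F) (split 4F 5F (✗ 0F 4F 5F) (✗ 0F 4F 5F) (split 0F 6F (✓ 1F
  1F) (✓ 1F 1F) (split 5F 6F (✓ 1F 3F) (split 1F 4F (✓ 0F 3F) (split 2F 6F (✓ 0F 5F) (✓ 1F 4F) (✓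
  0F 5F)) (✓ 0F 3F)) (✓ 1F 3F))))))) (split 1F 6F (✓ 1F 6F) (✓ 0F 5F) (split 2F 5F (✗ 0F 2F 5F) (✗
  0F 2F 5F) (split 4F 5F (✗ 0F 4F 5F) (✗ 0F 4F 5F) (✓ 1F 3F)))) (split 0F 6F (split 1F 5F (✓ 1F
  5F) (✓ 0F 6F) (split 2F 6F (✗ 0F 2F 6F) (✗ 0F 2F 6F) (split 3F 6F (✗ 0F 3F 6F) (✗ 0F 3F 6F)
  (split 4F 6F (✗ 0F 4F 6F) (✗ 0F 4F 6F) (split 5F 6F (✓ 1F 3F) (split 1F 4F (✓ 0F 3F) (split 2F
  5F (✓ 0F 6F) (✓ 1F 4F) (✓ 0F 6F)) (✓ 0F 3F)) (✓ 1F 3F)))))) (split 1F 5F (✓ 1F 5F) (✓ 0F 6F)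
  (split 2F 6F (✗ 0F 2F 6F) (✗ 0F 2F 6F) (split 4F 6F (✗ 0F 4F 6F) (✗ 0F 4F 6F) (✓ 1F 3F))))
  (split 1F 4F (split 5F 6F (split 2F 5F (✓ 0F 3F) (split 2F 6F (✗ 2F 5F 6F) (✗ 2F 5F 6F) (split
  3F 6F (✓ 1F 4F) (split 4F 5F (✓ 0F 2F) (✓ 1F 3F) (✓ 0F 2F)) (✓ 1F 4F))) (split 2F 6F (✓ 0F 3F)
  (split 3F 5F (✓ 1F 4F) (split 4F 5F (✓ 1F 3F) (✓ 2F 6F) (✓ 1F 3F)) (✓ 1F 4F)) (✓ 0F 3F))) (✓ 0F
  3F) (split 1F 5F (split 3F 6F (✓ 1F 5F) (✓ 3F 6F) (✓ 1F 5F)) (split 3F 5F (✗ 1F 3F 5F) (✗ 1F 3F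
  5F) (split 1F 6F (✓ 1F 6F) (✓ 1F 6F) (split 2F 6F (split 4F 6F (✓ 0F 3F) (✓ 1F 5F) (✓ 0F 2F)) (✓
  1F 4F) (✓ 0F 4F)))) (split 3F 6F (✓ 3F 6F) (✓ 3F 6F) (split 3F 5F (✓ 1F 4F) (split 1F 6F (✓ 3F
  5F) (split 2F 5F (split 4F 5F (✓ 0F 3F) (✓ 1F 6F) (✓ 0F 2F)) (✓ 1F 4F) (✓ 0F 4F)) (✓ 3F 5F)) (✓
  1F 4F))))) (split 1F 5F (split 3F 5F (✗ 1F 3F 5F) (✗ 1F 3F 5F) (split 1F 6F (✓ 1F 6F) (✓ 1F 6F)
  (split 2F 6F (✓ 2F 6F) (✓ 1F 4F) (split 3F 6F (✓ 1F 5F) (split 2F 5F (✓ 0F 4F) (split 4F 5F (✗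
  1F 4F 5F) (✗ 1F 4F 5F) (split 4F 6F (✓ 0F 2F) (✓ 2F 2F) (✓ 1F 3F))) (✓ 0F 4F)) (✓ 1F 5F)))))
  (split 3F 5F (✗ 1F 3F 5F) (✗ 1F 3F 5F) (split 4F 5F (✗ 1F 4F 5F) (✗ 1F 4F 5F) (✓ 0F 2F))) (split
  1F 6F (split 3F 5F (✓ 1F 6F) (split 2F 6F (✓ 0F 4F) (split 3F 6F (✗ 1F 3F 6F) (✗ 1F 3F 6F)
  (split 2F 5F (✓ 2F 5F) (✓ 1F 4F) (split 4F 5F (✓ 2F 6F) (✓ 2F 2F) (split 4F 6F (✗ 1F 4F 6F) (✗
  1F 4F 6F) (✓ 1F 3F))))) (✓ 0F 4F)) (✓ 1F 6F)) (split 3F 5F (✓ 1F 6F) (split 4F 6F (✗ 1F 4F 6F)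
  (✗ 1F 4F 6F) (✓ 0F 2F)) (✓ 1F 6F)) (split 2F 5F (split 3F 6F (✓ 2F 5F) (✓ 0F 4F) (✓ 2F 5F))
  (split 3F 6F (✓ 1F 4F) (split 4F 5F (split 2F 6F (✓ 2F 6F) (✓ 1F 4F) (split 3F 5F (✓ 3F 5F) (✓
  0F 4F) (split 5F 6F (✓ 0F 2F) (✓ 0F 4F) (✓ 0F 2F)))) (✓ 1F 3F) (✓ 3F 6F)) (✓ 1F 4F)) (split 3F
  6F (✓ 3F 6F) (✓ 0F 4F) (split 3F 5F (split 2F 6F (✓ 2F 6F) (✓ 1F 4F) (✓ 1F 4F)) (split 2F 6F (✓
  0F 4F) (split 4F 5F (✓ 2F 6F) (✓ 2F 2F) (split 5F 6F (✓ 1F 3F) (✓ 0F 4F) (✓ 0F 2F))) (✓ 0F 4F))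
  (✓ 0F 4F)))))) (split 5F 6F (split 2F 5F (✓ 1F 3F) (split 2F 6F (✗ 2F 5F 6F) (✗ 2F 5F 6F) (split
  4F 5F (✓ 1F 3F) (✓ 1F 3F) (split 3F 6F (✓ 3F 6F) (✓ 3F 6F) (split 1F 5F (✓ 1F 5F) (✓ 0F 4F)
  (split 4F 6F (✓ 0F 2F) (split 3F 5F (✓ 3F 5F) (✓ 3F 5F) (split 1F 6F (✓ 0F 4F) (✓ 0F 2F) (✓ 0F
  2F))) (✓ 0F 2F)))))) (split 2F 6F (✓ 0F 4F) (split 4F 5F (✓ 1F 3F) (split 3F 6F (✓ 3F 6F) (✓ 3F
  6F) (split 1F 5F (✓ 1F 5F) (✓ 1F 5F) (split 4F 6F (✗ 4F 5F 6F) (✗ 4F 5F 6F) (split 3F 5F (✓ 3F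
  5F) (✓ 3F 5F) (split 1F 6F (✓ 0F 2F) (✓ 0F 4F) (✓ 0F 2F)))))) (✓ 1F 3F)) (✓ 0F 4F))) (✓ 0F 3F)
  (split 1F 5F (split 3F 6F (✓ 1F 5F) (✓ 3F 6F) (✓ 1F 5F)) (split 3F 5F (✗ 1F 3F 5F) (✗ 1F 3F 5F)
  (split 1F 6F (✓ 1F 6F) (✓ 1F 6F) (split 3F 6F (✓ 1F 5F) (split 2F 5F (split 4F 6F (✓ 1F 3F) (✓
  1F 3F) (✓ 0F 2F)) (split 2F 6F (split 4F 5F (✓ 1F 3F) (✓ 3F 3F) (✓ 0F 2F)) (✓ 0F 4F) (✓ 0F 4F))
  (✓ 0F 4F)) (✓ 1F 5F)))) (split 3F 6F (✓ 3F 6F) (✓ 3F 6F) (split 1F 6F (split 3F 5F (✓ 1F 6F) (✓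
  3F 5F) (✓ 1F 6F)) (split 3F 5F (✓ 1F 6F) (split 2F 5F (split 4F 5F (✓ 0F 3F) (✓ 1F 6F) (✓ 0F
  2F)) (split 4F 5F (✓ 1F 6F) (✓ 1F 1F) (✓ 0F 2F)) (✓ 0F 4F)) (✓ 1F 6F)) (split 3F 5F (✓ 3F 5F) (✓
  3F 5F) (✓ 0F 2F))))))))))) (split 0F 5F (split 2F 5F (✗ 0F 2F 5F) (✗ 0F 2F 5F) (split 3F 5F (✗
  0F 3F 5F) (✗ 0F 3F 5F) (split 0F 6F (split 1F 4F (✓ 1F 4F) (✓ 0F 6F) (split 2F 6F (✗ 0F 2F 6F)
  (✗ 0F 2F 6F) (split 3F 6F (✗ 0F 3F 6F) (✗ 0F 3F 6F) (split 5F 6F (✗ 0F 5F 6F) (✗ 0F 5F 6F)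
  (split 2F 4F (✓ 1F 1F) (✓ 1F 1F) (split 4F 5F (✓ 0F 6F) (split 1F 6F (✓ 0F 3F) (✓ 0F 5F) (✓ 0F
  3F)) (✓ 0F 6F))))))) (split 1F 4F (✓ 1F 4F) (✓ 0F 6F) (split 2F 6F (✗ 0F 2F 6F) (✗ 0F 2F 6F)
  (split 3F 6F (✗ 0F 3F 6F) (✗ 0F 3F 6F) (split 5F 6F (✗ 0F 5F 6F) (✗ 0F 5F 6F) (split 4F 5F (✓ 1F
  3F) (split 1F 6F (✓ 0F 3F) (split 2F 4F (✓ 0F 5F) (✓ 1F 6F) (✓ 0F 5F)) (✓ 0F 3F)) (✓ 1F 3F))))))
  (split 1F 4F (split 2F 6F (✓ 1F 4F) (✓ 1F 4F) (split 3F 4F (✗ 1F 3F 4F) (✗ 1F 3F 4F) (split 1F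
  5F (split 2F 4F (✓ 0F 3F) (split 3F 6F (✓ 2F 2F) (✓ 2F 4F) (✓ 1F 5F)) (✓ 0F 3F)) (split 2F 4F (✓
  2F 4F) (✓ 2F 4F) (split 3F 6F (✓ 0F 5F) (✓ 0F 5F) (✓ 1F 5F))) (split 4F 6F (split 1F 6F (✗ 1F 4F
  6F) (✗ 1F 4F 6F) (split 2F 4F (✓ 0F 3F) (split 3F 6F (✓ 3F 6F) (✓ 2F 4F) (✓ 2F 4F)) (✓ 0F 3F)))
  (✓ 0F 3F) (split 2F 4F (✓ 0F 5F) (split 1F 6F (✓ 1F 6F) (✓ 1F 6F) (split 3F 6F (✓ 3F 6F) (✓ 2F
  4F) (✓ 2F 4F))) (✓ 0F 5F)))))) (split 2F 6F (✓ 1F 4F) (✓ 1F 4F) (split 2F 4F (✓ 0F 5F) (split 3F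
  6F (✓ 0F 5F) (✓ 2F 4F) (✓ 0F 5F)) (✓ 0F 5F))) (split 1F 5F (split 4F 6F (split 2F 4F (✓ 0F 3F)
  (split 3F 6F (✓ 1F 5F) (✓ 2F 4F) (✓ 1F 5F)) (split 2F 6F (✓ 0F 3F) (split 3F 4F (✓ 1F 5F) (✓ 2F
  6F) (✓ 1F 5F)) (✓ 0F 3F))) (✓ 0F 3F) (split 1F 6F (split 2F 4F (✓ 1F 6F) (✓ 1F 6F) (split 5F 6F
  (✗ 1F 5F 6F) (✗ 1F 5F 6F) (✓ 0F 3F))) (split 2F 4F (✓ 1F 6F) (✓ 1F 6F) (split 3F 6F (✗ 1F 3F 6F)
  (✗ 1F 3F 6F) (✓ 0F 5F))) (split 2F 4F (split 5F 6F (✓ 3F 3F) (✓ 0F 3F) (✓ 2F 4F)) (split 3F 6F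
  (✓ 1F 5F) (✓ 2F 4F) (✓ 1F 5F)) (split 2F 6F (✓ 0F 3F) (split 3F 4F (✓ 1F 5F) (✓ 2F 6F) (✓ 1F
  5F)) (✓ 0F 3F))))) (split 2F 4F (✓ 2F 4F) (✓ 2F 4F) (split 2F 6F (✓ 2F 6F) (✓ 2F 6F) (split 4F
  6F (✓ 0F 3F) (split 1F 6F (split 3F 4F (✓ 0F 5F) (✓ 0F 5F) (split 3F 6F (✗ 1F 3F 6F) (✗ 1F 3F
  6F) (✓ 1F 5F))) (✓ 0F 0F) (split 3F 4F (split 3F 6F (✗ 3F 4F 6F) (✗ 3F 4F 6F) (✓ 1F 5F)) (✓ 0F
  5F) (split 3F 6F (✓ 1F 5F) (✓ 0F 5F) (✓ 0F 5F)))) (✓ 0F 3F)))) (split 4F 6F (split 1F 6F (split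
  2F 4F (✓ 0F 3F) (✓ 1F 6F) (split 2F 6F (✓ 0F 3F) (split 3F 4F (✓ 3F 4F) (✓ 2F 6F) (✓ 2F 6F)) (✓
  0F 3F))) (split 2F 4F (✓ 0F 5F) (✓ 1F 6F) (split 2F 6F (✓ 0F 5F) (split 3F 4F (✓ 0F 5F) (✓ 2F
  6F) (✓ 0F 5F)) (✓ 0F 5F))) (split 2F 4F (✓ 0F 3F) (split 3F 6F (✓ 3F 6F) (✓ 2F 4F) (✓ 2F 4F))
  (split 2F 6F (✓ 0F 3F) (split 3F 4F (✓ 3F 4F) (✓ 2F 6F) (✓ 2F 6F)) (✓ 0F 3F)))) (✓ 0F 3F) (split
  1F 6F (split 2F 4F (✓ 1F 6F) (✓ 1F 6F) (split 2F 6F (✓ 0F 3F) (split 3F 4F (✓ 3F 4F) (✓ 2F 6F)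
  (✓ 2F 6F)) (✓ 0F 3F))) (split 2F 4F (✓ 1F 6F) (✓ 1F 6F) (split 3F 6F (✗ 1F 3F 6F) (✗ 1F 3F 6F)
  (✓ 0F 5F))) (split 2F 4F (split 3F 6F (✓ 3F 6F) (✓ 0F 5F) (✓ 2F 4F)) (split 3F 6F (✓ 3F 6F) (✓
  2F 4F) (✓ 2F 4F)) (split 2F 6F (✓ 0F 3F) (split 3F 4F (✓ 3F 4F) (✓ 2F 6F) (✓ 2F 6F)) (✓ 0F
  3F)))))))))) (split 2F 5F (✗ 0F 2F 5F) (✗ 0F 2F 5F) (split 3F 5F (✗ 0F 3F 5F) (✗ 0F 3F 5F)
  (split 0F 6F (split 1F 4F (✓ 1F 4F) (✓ 0F 6F) (split 2F 6F (✗ 0F 2F 6F) (✗ 0F 2F 6F) (split 3F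
  6F (✗ 0F 3F 6F) (✗ 0F 3F 6F) (split 5F 6F (✗ 0F 5F 6F) (✗ 0F 5F 6F) (split 4F 6F (✓ 1F 3F)
  (split 1F 5F (✓ 0F 3F) (split 2F 4F (✓ 0F 6F) (✓ 1F 5F) (✓ 0F 6F)) (✓ 0F 3F)) (✓ 1F 3F))))))
  (split 1F 4F (✓ 1F 4F) (✓ 0F 6F) (split 2F 6F (✗ 0F 2F 6F) (✗ 0F 2F 6F) (split 5F 6F (✗ 0F 5F
  6F) (✗ 0F 5F 6F) (✓ 1F 3F)))) (split 1F 4F (split 3F 4F (✗ 1F 3F 4F) (✗ 1F 3F 4F) (split 1F 6F
  (✓ 1F 6F) (✓ 1F 6F) (split 3F 6F (✓ 1F 4F) (split 1F 5F (✓ 3F 6F) (split 2F 4F (✓ 0F 5F) (split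
  2F 6F (✓ 2F 6F) (✓ 1F 5F) (split 4F 5F (✗ 1F 4F 5F) (✗ 1F 4F 5F) (split 5F 6F (✓ 0F 2F) (✓ 2F
  2F) (✓ 1F 3F)))) (✓ 0F 5F)) (✓ 3F 6F)) (✓ 1F 4F)))) (split 3F 4F (✗ 1F 3F 4F) (✗ 1F 3F 4F)
  (split 1F 6F (✓ 1F 6F) (✓ 1F 6F) (split 3F 6F (✓ 1F 4F) (split 4F 6F (split 2F 4F (✓ 0F 5F)
  (split 2F 6F (✗ 2F 4F 6F) (✗ 2F 4F 6F) (split 4F 5F (✓ 0F 2F) (✓ 3F 3F) (split 1F 5F (✓ 0F 2F)
  (✓ 0F 2F) (✓ 3F 6F)))) (split 4F 5F (✓ 0F 2F) (✓ 3F 6F) (✓ 1F 3F))) (✓ 0F 2F) (split 2F 4F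
  (split 5F 6F (✓ 1F 3F) (✓ 1F 3F) (✓ 0F 2F)) (split 2F 6F (split 5F 6F (✓ 0F 3F) (✓ 1F 4F) (✓ 0F
  2F)) (✓ 0F 5F) (✓ 0F 5F)) (✓ 0F 5F))) (✓ 1F 4F)))) (split 1F 5F (split 3F 6F (✓ 3F 6F) (✓ 3F 6F)
  (split 2F 4F (split 4F 5F (✓ 0F 3F) (split 1F 6F (✓ 1F 6F) (✓ 1F 6F) (split 3F 4F (✓ 3F 4F) (✓
  3F 4F) (✓ 0F 5F))) (✓ 0F 3F)) (✓ 1F 5F) (split 4F 5F (✓ 0F 3F) (split 2F 6F (split 1F 6F (✓ 0F
  3F) (✓ 0F 5F) (✓ 0F 3F)) (split 3F 4F (✓ 1F 5F) (✓ 2F 6F) (✓ 1F 5F)) (✓ 1F 3F)) (✓ 0F 3F))))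
  (split 1F 6F (split 3F 4F (✓ 1F 6F) (split 2F 6F (✓ 0F 5F) (split 3F 6F (✗ 1F 3F 6F) (✗ 1F 3F
  6F) (split 2F 4F (✓ 2F 4F) (✓ 1F 5F) (split 4F 5F (✓ 2F 6F) (✓ 2F 2F) (split 5F 6F (✗ 1F 5F 6F)
  (✗ 1F 5F 6F) (✓ 1F 3F))))) (✓ 0F 5F)) (✓ 1F 6F)) (split 3F 4F (✓ 1F 6F) (split 5F 6F (✗ 1F 5F
  6F) (✗ 1F 5F 6F) (✓ 0F 2F)) (✓ 1F 6F)) (split 2F 4F (split 3F 6F (✓ 2F 4F) (✓ 0F 5F) (✓ 2F 4F))
  (split 3F 6F (✓ 1F 5F) (split 4F 5F (split 2F 6F (✓ 2F 6F) (✓ 1F 5F) (split 3F 4F (✓ 3F 4F) (✓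
  0F 5F) (split 4F 6F (✓ 0F 2F) (✓ 0F 5F) (✓ 0F 2F)))) (✓ 1F 3F) (✓ 3F 6F)) (✓ 1F 5F)) (split 3F
  6F (✓ 3F 6F) (✓ 0F 5F) (split 3F 4F (split 2F 6F (✓ 2F 6F) (✓ 1F 5F) (✓ 1F 5F)) (split 2F 6F (✓
  0F 5F) (split 4F 5F (✓ 2F 6F) (✓ 2F 2F) (split 4F 6F (✓ 1F 3F) (✓ 0F 5F) (✓ 0F 2F))) (✓ 0F 5F))
  (✓ 0F 5F))))) (split 3F 6F (✓ 3F 6F) (✓ 3F 6F) (split 4F 6F (split 2F 4F (✓ 1F 3F) (split 2F 6F
  (✗ 2F 4F 6F) (✗ 2F 4F 6F) (split 4F 5F (✓ 1F 1F) (✓ 1F 1F) (split 5F 6F (✓ 0F 2F) (split 3F 4F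
  (✓ 3F 4F) (✓ 3F 4F) (split 1F 6F (✓ 0F 5F) (✓ 0F 2F) (✓ 0F 2F))) (✓ 0F 2F)))) (split 2F 6F (✓ 0F
  5F) (split 4F 5F (✓ 0F 3F) (split 5F 6F (✗ 4F 5F 6F) (✗ 4F 5F 6F) (split 3F 4F (✓ 3F 4F) (✓ 3F
  4F) (split 1F 6F (✓ 0F 2F) (✓ 0F 5F) (✓ 0F 2F)))) (✓ 0F 3F)) (✓ 0F 5F))) (✓ 0F 3F) (split 1F 6F
  (split 3F 4F (✓ 1F 6F) (✓ 3F 4F) (✓ 1F 6F)) (split 3F 4F (✓ 1F 6F) (split 2F 4F (split 4F 5F (✓
  0F 3F) (✓ 1F 6F) (✓ 0F 2F)) (split 4F 5F (✓ 1F 6F) (✓ 1F 1F) (✓ 0F 2F)) (✓ 0F 5F)) (✓ 1F 6F))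
  (split 3F 4F (✓ 3F 4F) (✓ 3F 4F) (✓ 0F 2F)))))))))) (split 0F 6F (split 2F 6F (✗ 0F 2F 6F) (✗ 0F
  2F 6F) (split 3F 6F (✗ 0F 3F 6F) (✗ 0F 3F 6F) (split 1F 4F (split 2F 5F (✓ 1F 4F) (✓ 1F 4F)
  (split 3F 4F (✗ 1F 3F 4F) (✗ 1F 3F 4F) (split 1F 5F (split 2F 4F (✓ 0F 3F) (✓ 1F 5F) (✓ 0F 3F))
  (split 2F 4F (✓ 0F 6F) (✓ 1F 5F) (✓ 0F 6F)) (split 4F 6F (split 1F 6F (✗ 1F 4F 6F) (✗ 1F 4F 6F)
  (split 2F 4F (✓ 0F 3F) (split 3F 5F (✓ 3F 5F) (✓ 2F 2F) (✓ 2F 4F)) (✓ 0F 3F))) (✓ 0F 3F) (split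
  1F 6F (split 2F 4F (✓ 0F 3F) (split 3F 5F (✓ 2F 2F) (✓ 2F 2F) (✓ 1F 6F)) (✓ 0F 3F)) (split 2F 4F
  (✓ 2F 4F) (✓ 2F 4F) (split 3F 5F (✓ 0F 6F) (✓ 0F 6F) (✓ 1F 6F))) (split 2F 4F (✓ 0F 3F) (split
  3F 5F (✓ 3F 5F) (✓ 2F 2F) (✓ 2F 4F)) (✓ 0F 3F))))))) (split 2F 5F (✓ 1F 4F) (✓ 1F 4F) (split 2F
  4F (✓ 0F 6F) (split 3F 5F (✓ 0F 6F) (✓ 2F 4F) (✓ 0F 6F)) (✓ 0F 6F))) (split 1F 5F (split 2F 4F
  (✓ 1F 5F) (✓ 1F 5F) (split 3F 5F (✗ 1F 3F 5F) (✗ 1F 3F 5F) (split 5F 6F (split 1F 6F (✗ 1F 5F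
  6F) (✗ 1F 5F 6F) (split 2F 5F (✓ 0F 3F) (split 3F 4F (✓ 3F 4F) (✓ 2F 2F) (✓ 2F 5F)) (✓ 0F 3F)))
  (✓ 0F 3F) (split 1F 6F (split 2F 5F (✓ 0F 3F) (split 3F 4F (✓ 2F 2F) (✓ 2F 2F) (✓ 1F 6F)) (✓ 0F
  3F)) (split 2F 5F (✓ 2F 5F) (✓ 2F 5F) (split 3F 4F (✓ 0F 6F) (✓ 0F 6F) (✓ 1F 6F))) (split 2F 5F
  (✓ 0F 3F) (split 3F 4F (✓ 3F 4F) (✓ 2F 2F) (✓ 2F 5F)) (✓ 0F 3F)))))) (split 2F 4F (✓ 1F 5F) (✓
  1F 5F) (split 2F 5F (✓ 0F 6F) (split 3F 4F (✓ 0F 6F) (✓ 2F 5F) (✓ 0F 6F)) (✓ 0F 6F))) (split 1F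
  6F (split 4F 5F (split 2F 4F (✓ 0F 3F) (split 3F 5F (✓ 1F 6F) (✓ 2F 4F) (✓ 1F 6F)) (split 2F 5F
  (✓ 0F 3F) (split 3F 4F (✓ 1F 6F) (✓ 2F 5F) (✓ 1F 6F)) (✓ 0F 3F))) (✓ 0F 3F) (split 2F 4F (split
  5F 6F (✓ 3F 3F) (✓ 0F 3F) (✓ 2F 4F)) (split 3F 5F (✓ 1F 6F) (✓ 2F 4F) (✓ 1F 6F)) (split 2F 5F (✓
  0F 3F) (split 3F 4F (✓ 1F 6F) (✓ 2F 5F) (✓ 1F 6F)) (✓ 0F 3F)))) (split 2F 4F (✓ 2F 4F) (✓ 2F 4F)
  (split 2F 5F (✓ 2F 5F) (✓ 2F 5F) (split 4F 5F (✓ 0F 3F) (split 3F 4F (split 3F 5F (✗ 3F 4F 5F)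
  (✗ 3F 4F 5F) (✓ 1F 6F)) (✓ 0F 6F) (split 3F 5F (✓ 1F 6F) (✓ 0F 6F) (✓ 0F 6F))) (✓ 0F 3F))))
  (split 4F 5F (split 2F 4F (✓ 0F 3F) (split 3F 5F (✓ 3F 5F) (✓ 2F 4F) (✓ 2F 4F)) (split 2F 5F (✓
  0F 3F) (split 3F 4F (✓ 3F 4F) (✓ 2F 5F) (✓ 2F 5F)) (✓ 0F 3F))) (✓ 0F 3F) (split 2F 4F (split 3F
  5F (✓ 3F 5F) (✓ 0F 6F) (✓ 2F 4F)) (split 3F 5F (✓ 3F 5F) (✓ 2F 4F) (✓ 2F 4F)) (split 2F 5F (✓ 0F
  3F) (split 3F 4F (✓ 3F 4F) (✓ 2F 5F) (✓ 2F 5F)) (✓ 0F 3F))))))))) (split 2F 6F (✗ 0F 2F 6F) (✗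
  0F 2F 6F) (split 3F 6F (✗ 0F 3F 6F) (✗ 0F 3F 6F) (split 1F 4F (split 3F 4F (✗ 1F 3F 4F) (✗ 1F 3F
  4F) (split 1F 5F (✓ 1F 5F) (✓ 1F 5F) (split 3F 5F (✓ 1F 4F) (split 1F 6F (✓ 3F 5F) (split 2F 4F
  (✓ 0F 6F) (split 2F 5F (✓ 2F 5F) (✓ 1F 6F) (split 4F 6F (✗ 1F 4F 6F) (✗ 1F 4F 6F) (split 5F 6F
  (✓ 0F 2F) (✓ 2F 2F) (✓ 1F 3F)))) (✓ 0F 6F)) (✓ 3F 5F)) (✓ 1F 4F)))) (split 3F 4F (✗ 1F 3F 4F) (✗
  1F 3F 4F) (split 1F 5F (✓ 1F 5F) (✓ 1F 5F) (split 3F 5F (✓ 1F 4F) (split 4F 5F (split 2F 4F (✓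
  0F 6F) (split 2F 5F (✗ 2F 4F 5F) (✗ 2F 4F 5F) (split 4F 6F (✓ 0F 2F) (✓ 3F 3F) (split 1F 6F (✓
  0F 2F) (✓ 0F 2F) (✓ 3F 5F)))) (split 4F 6F (✓ 0F 2F) (✓ 3F 5F) (✓ 1F 3F))) (✓ 0F 2F) (split 2F
  4F (split 5F 6F (✓ 1F 3F) (✓ 1F 3F) (✓ 0F 2F)) (split 2F 5F (split 5F 6F (✓ 0F 3F) (✓ 1F 4F) (✓
  0F 2F)) (✓ 0F 6F) (✓ 0F 6F)) (✓ 0F 6F))) (✓ 1F 4F)))) (split 1F 5F (split 3F 4F (✓ 1F 5F) (split
  1F 6F (✓ 3F 4F) (split 2F 5F (✓ 0F 6F) (split 3F 5F (✗ 1F 3F 5F) (✗ 1F 3F 5F) (split 2F 4F (✓ 2F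
  4F) (✓ 1F 6F) (split 4F 6F (✓ 2F 5F) (✓ 2F 2F) (split 5F 6F (✗ 1F 5F 6F) (✗ 1F 5F 6F) (✓ 1F
  3F))))) (✓ 0F 6F)) (✓ 3F 4F)) (✓ 1F 5F)) (split 3F 4F (✓ 1F 5F) (split 3F 5F (✗ 1F 3F 5F) (✗ 1F
  3F 5F) (split 4F 5F (split 2F 4F (✓ 0F 6F) (split 1F 6F (✓ 1F 6F) (✓ 1F 6F) (split 2F 5F (✗ 2F
  4F 5F) (✗ 2F 4F 5F) (split 5F 6F (✓ 0F 2F) (✓ 3F 4F) (✓ 1F 3F)))) (split 2F 5F (✓ 0F 6F) (split
  4F 6F (✓ 0F 2F) (split 1F 6F (✓ 0F 2F) (✓ 2F 2F) (split 5F 6F (✗ 4F 5F 6F) (✗ 4F 5F 6F) (✓ 3F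
  4F))) (✓ 0F 3F)) (✓ 0F 6F))) (✓ 0F 2F) (split 2F 4F (split 4F 6F (✓ 0F 3F) (✓ 1F 5F) (✓ 0F 2F))
  (split 4F 6F (✓ 1F 5F) (✓ 1F 1F) (✓ 0F 2F)) (✓ 0F 6F)))) (✓ 1F 5F)) (split 1F 6F (split 3F 4F (✓
  3F 4F) (✓ 3F 4F) (split 3F 5F (✓ 3F 5F) (✓ 3F 5F) (✓ 0F 6F))) (split 2F 4F (split 3F 5F (✓ 2F
  4F) (✓ 0F 6F) (✓ 2F 4F)) (split 3F 5F (✓ 1F 6F) (split 4F 6F (split 2F 5F (✓ 2F 5F) (✓ 1F 6F)
  (split 3F 4F (✓ 3F 4F) (✓ 0F 6F) (split 4F 5F (✓ 0F 2F) (✓ 0F 6F) (✓ 0F 2F)))) (✓ 1F 3F) (✓ 3F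
  5F)) (✓ 1F 6F)) (split 3F 5F (✓ 3F 5F) (✓ 0F 6F) (split 3F 4F (split 2F 5F (✓ 2F 5F) (✓ 1F 6F)
  (✓ 1F 6F)) (split 2F 5F (✓ 0F 6F) (split 4F 5F (split 4F 6F (✓ 2F 2F) (✓ 2F 2F) (✓ 1F 3F)) (✓ 0F
  6F) (✓ 0F 6F)) (✓ 0F 6F)) (✓ 0F 6F)))) (split 3F 4F (✓ 3F 4F) (✓ 3F 4F) (split 3F 5F (✓ 3F 5F)
  (✓ 3F 5F) (✓ 0F 2F)))))))) (split 1F 4F (split 3F 4F (✗ 1F 3F 4F) (✗ 1F 3F 4F) (split 1F 5F
  (split 2F 6F (✓ 2F 6F) (✓ 1F 5F) (split 3F 5F (✗ 1F 3F 5F) (✗ 1F 3F 5F) (split 4F 5F (✗ 1F 4F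
  5F) (✗ 1F 4F 5F) (split 1F 6F (✓ 2F 2F) (✓ 2F 2F) (split 3F 6F (✓ 2F 2F) (✓ 2F 2F) (split 2F 4F
  (split 2F 5F (✓ 0F 3F) (✓ 1F 4F) (✓ 0F 3F)) (✓ 1F 5F) (✓ 1F 5F))))))) (split 2F 4F (✓ 2F 4F) (✓
  2F 4F) (split 2F 6F (✓ 2F 6F) (✓ 1F 5F) (split 3F 5F (✗ 1F 3F 5F) (✗ 1F 3F 5F) (split 3F 6F (✓
  1F 5F) (split 2F 5F (✓ 2F 5F) (✓ 2F 5F) (✓ 1F 3F)) (✓ 1F 5F))))) (split 1F 6F (split 2F 5F (✓ 2F
  5F) (✓ 1F 6F) (split 3F 6F (✗ 1F 3F 6F) (✗ 1F 3F 6F) (split 4F 6F (✗ 1F 4F 6F) (✗ 1F 4F 6F)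
  (split 3F 5F (✓ 2F 2F) (✓ 2F 2F) (split 2F 4F (split 2F 6F (✓ 0F 3F) (✓ 1F 4F) (✓ 0F 3F)) (✓ 1F
  6F) (✓ 1F 6F)))))) (split 2F 4F (✓ 2F 4F) (✓ 2F 4F) (split 2F 5F (✓ 2F 5F) (✓ 1F 6F) (split 3F
  5F (✓ 1F 6F) (split 2F 6F (✓ 2F 6F) (✓ 2F 6F) (✓ 1F 3F)) (✓ 1F 6F)))) (split 2F 4F (split 5F 6F
  (✓ 0F 3F) (✓ 0F 3F) (✓ 2F 4F)) (split 3F 5F (✓ 3F 5F) (✓ 2F 4F) (split 3F 6F (✓ 3F 6F) (✓ 2F 4F)
  (✓ 2F 4F))) (split 5F 6F (split 2F 5F (✓ 0F 3F) (split 3F 6F (✓ 1F 4F) (✓ 2F 5F) (✓ 1F 4F))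
  (split 2F 6F (✓ 0F 3F) (split 3F 5F (✓ 1F 4F) (✓ 2F 6F) (✓ 1F 4F)) (✓ 3F 3F))) (✓ 0F 3F) (split
  2F 5F (split 4F 6F (✓ 0F 3F) (✓ 0F 3F) (✓ 2F 5F)) (split 3F 6F (✓ 1F 4F) (✓ 2F 5F) (✓ 1F 4F))
  (split 2F 6F (✓ 0F 3F) (split 3F 5F (✓ 1F 4F) (✓ 2F 6F) (✓ 1F 4F)) (✓ 3F 3F)))))))) (split 2F 5F
  (✓ 2F 5F) (✓ 2F 5F) (split 2F 6F (✓ 2F 6F) (✓ 2F 6F) (split 3F 4F (✗ 1F 3F 4F) (✗ 1F 3F 4F)
  (split 5F 6F (✓ 0F 3F) (split 1F 5F (split 1F 6F (✗ 1F 5F 6F) (✗ 1F 5F 6F) (split 3F 5F (✗ 1F 3F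
  5F) (✗ 1F 3F 5F) (split 3F 6F (✓ 1F 4F) (split 2F 4F (✓ 2F 4F) (✓ 2F 4F) (✓ 1F 3F)) (✓ 1F 4F))))
  (✓ 2F 2F) (split 1F 6F (split 3F 6F (✗ 1F 3F 6F) (✗ 1F 3F 6F) (split 3F 5F (✓ 1F 4F) (split 2F
  4F (✓ 2F 4F) (✓ 2F 4F) (✓ 1F 3F)) (✓ 1F 4F))) (✓ 2F 2F) (split 2F 4F (split 3F 5F (split 3F 6F
  (✗ 3F 5F 6F) (✗ 3F 5F 6F) (✓ 1F 4F)) (✓ 2F 4F) (split 3F 6F (✓ 1F 4F) (✓ 2F 4F) (✓ 1F 4F)))
  (split 3F 5F (✓ 3F 5F) (✓ 2F 4F) (split 3F 6F (✓ 1F 4F) (✓ 2F 4F) (✓ 1F 4F))) (✓ 1F 3F)))) (✓ 0F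
  3F))))) (split 1F 5F (split 3F 5F (✗ 1F 3F 5F) (✗ 1F 3F 5F) (split 1F 6F (split 2F 4F (✓ 2F 4F)
  (✓ 1F 6F) (split 3F 6F (✗ 1F 3F 6F) (✗ 1F 3F 6F) (split 5F 6F (✗ 1F 5F 6F) (✗ 1F 5F 6F) (split
  3F 4F (✓ 2F 2F) (✓ 2F 2F) (split 2F 5F (split 2F 6F (✓ 0F 3F) (✓ 1F 5F) (✓ 0F 3F)) (✓ 1F 6F) (✓
  1F 6F)))))) (split 2F 4F (✓ 2F 4F) (✓ 1F 6F) (split 2F 5F (✓ 2F 5F) (✓ 2F 5F) (split 3F 4F (✓ 1F
  6F) (split 2F 6F (✓ 2F 6F) (✓ 2F 6F) (✓ 1F 3F)) (✓ 1F 6F)))) (split 2F 4F (split 5F 6F (✓ 0F 3F)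
  (✓ 0F 3F) (✓ 2F 4F)) (split 3F 6F (✓ 1F 5F) (✓ 2F 4F) (✓ 1F 5F)) (split 5F 6F (split 3F 4F (✓ 3F
  4F) (✓ 2F 2F) (split 2F 6F (✓ 0F 3F) (✓ 1F 5F) (split 2F 5F (✓ 0F 3F) (split 3F 6F (✓ 1F 5F) (✓
  2F 5F) (✓ 1F 5F)) (✓ 3F 3F)))) (✓ 0F 3F) (split 3F 4F (✓ 3F 4F) (✓ 2F 2F) (split 2F 6F (split 4F
  5F (✓ 0F 3F) (✓ 0F 3F) (✓ 2F 6F)) (✓ 1F 5F) (split 2F 5F (✓ 0F 3F) (split 3F 6F (✓ 1F 5F) (✓ 2F
  5F) (✓ 1F 5F)) (✓ 3F 3F)))))))) (split 2F 4F (✓ 2F 4F) (✓ 2F 4F) (split 2F 6F (✓ 2F 6F) (✓ 2F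
  6F) (split 3F 5F (✗ 1F 3F 5F) (✗ 1F 3F 5F) (split 4F 6F (✓ 0F 3F) (split 1F 6F (split 3F 6F (✗
  1F 3F 6F) (✗ 1F 3F 6F) (split 3F 4F (✓ 1F 5F) (split 2F 5F (✓ 2F 5F) (✓ 2F 5F) (✓ 1F 3F)) (✓ 1F
  5F))) (✓ 2F 2F) (split 2F 5F (split 3F 4F (split 3F 6F (✗ 3F 4F 6F) (✗ 3F 4F 6F) (✓ 1F 5F)) (✓
  2F 5F) (split 3F 6F (✓ 1F 5F) (✓ 2F 5F) (✓ 1F 5F))) (split 3F 4F (✓ 3F 4F) (✓ 2F 5F) (split 3F
  6F (✓ 1F 5F) (✓ 2F 5F) (✓ 1F 5F))) (✓ 1F 3F))) (✓ 0F 3F))))) (split 1F 6F (split 3F 6F (✗ 1F 3F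
  6F) (✗ 1F 3F 6F) (split 2F 4F (split 5F 6F (✓ 0F 3F) (✓ 0F 3F) (✓ 2F 4F)) (split 3F 5F (✓ 1F 6F)
  (✓ 2F 4F) (✓ 1F 6F)) (split 5F 6F (split 3F 4F (✓ 3F 4F) (✓ 2F 2F) (split 2F 5F (✓ 0F 3F) (✓ 1F
  6F) (split 2F 6F (✓ 0F 3F) (split 3F 5F (✓ 1F 6F) (✓ 2F 6F) (✓ 1F 6F)) (✓ 3F 3F)))) (✓ 0F 3F)
  (split 3F 4F (✓ 3F 4F) (✓ 2F 2F) (split 2F 5F (split 4F 6F (✓ 0F 3F) (✓ 0F 3F) (✓ 2F 5F)) (✓ 1F
  6F) (split 2F 6F (✓ 0F 3F) (split 3F 5F (✓ 1F 6F) (✓ 2F 6F) (✓ 1F 6F)) (✓ 3F 3F))))))) (split 2F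
  4F (✓ 2F 4F) (✓ 2F 4F) (split 2F 5F (✓ 2F 5F) (✓ 2F 5F) (split 3F 6F (✗ 1F 3F 6F) (✗ 1F 3F 6F)
  (split 4F 5F (✓ 0F 3F) (split 2F 6F (split 3F 4F (split 3F 5F (✗ 3F 4F 5F) (✗ 3F 4F 5F) (✓ 1F
  6F)) (✓ 2F 6F) (split 3F 5F (✓ 1F 6F) (✓ 2F 6F) (✓ 1F 6F))) (split 3F 4F (✓ 3F 4F) (✓ 2F 6F)
  (split 3F 5F (✓ 1F 6F) (✓ 2F 6F) (✓ 1F 6F))) (✓ 1F 3F)) (✓ 0F 3F))))) (split 2F 4F (split 5F 6F
  (✓ 0F 3F) (✓ 0F 3F) (✓ 2F 4F)) (split 3F 5F (✓ 3F 5F) (✓ 2F 4F) (split 3F 6F (✓ 3F 6F) (✓ 2F 4F)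
  (✓ 2F 4F))) (split 5F 6F (split 3F 4F (✓ 3F 4F) (✓ 2F 2F) (split 2F 5F (✓ 0F 3F) (split 3F 6F (✓
  3F 6F) (✓ 2F 5F) (✓ 2F 5F)) (split 2F 6F (✓ 0F 3F) (split 3F 5F (✓ 3F 5F) (✓ 2F 6F) (✓ 2F 6F))
  (✓ 3F 3F)))) (✓ 0F 3F) (split 3F 4F (✓ 3F 4F) (✓ 2F 2F) (split 2F 5F (split 4F 6F (✓ 0F 3F) (✓
  0F 3F) (✓ 2F 5F)) (split 3F 6F (✓ 3F 6F) (✓ 2F 5F) (✓ 2F 5F)) (split 2F 6F (✓ 0F 3F) (split 3F
  5F (✓ 3F 5F) (✓ 2F 6F) (✓ 2F 6F)) (✓ 3F 3F)))))))))))


tightPath₀₁₂₃⇒transversal : ∀ {M : OverlapMatrix 7} → Admissible M → TightPath M 0F 1F 2F 3F →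
                            ∃ (Transversal M)
tightPath₀₁₂₃⇒transversal adm t =
  valid⇒transversal adm (tightPathKnowledge-agrees adm t) certificate tt

tightPath⇒transversal : ∀ {M : OverlapMatrix 7} → Admissible M →
                        ∀ {a b c d} → TightPath M a b c d → ∃ (Transversal M)
tightPath⇒transversal adm {a} {b} {c} {d} t
  with a≢b , a≢c , a≢d , b≢c , b≢d , c≢d ← tightPath-distinct adm t
  with π , π0≡a , π1≡b , π2≡c , π3≡d ← placement a b c d a≢b a≢c a≢d b≢c b≢d c≢d
  with S , T ← tightPath₀₁₂₃⇒transversal (relabel-admissible π adm)
                 (relabel-tightPath π (tightPath-cong (sym π0≡a) (sym π1≡b) (sym π2≡c) (sym π3≡d) t))
  = image π S , transversal-image π T

transversal-exists : ∀ {M : OverlapMatrix 7} → Admissible M → ∃ (Transversal M)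
transversal-exists {M} adm =
  fromDecision (any? λ a → any? λ b → any? λ c → any? λ d → tightPath? M a b c d)
  where
    fromDecision : Dec (∃[ a ] ∃[ b ] ∃[ c ] ∃[ d ] TightPath M a b c d) → ∃ (Transversal M)
    fromDecision (yes (_ , _ , _ , _ , t)) = tightPath⇒transversal adm t
    fromDecision (no ∄tightPath) = ∅ , record
      { pairwise-light = λ i∈∅ → contradiction i∈∅ ∉⊥
      ; meets          = λ t → contradiction (_ , _ , _ , _ , t) ∄tightPath
      }

module _ {n : ℕ} where

  ∈-triple⁻ : ∀ {x a b c : Fin n} → x ∈ triple a b c → x ≡ a ⊎ x ≡ b ⊎ x ≡ c
  ∈-triple⁻ {a = a} x∈ = Sum.map (x∈⁅y⁆⇒x≡y a) ∈-pair⁻ (x∈p∪q⁻ ⁅ a ⁆ _ x∈)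

  ∈-triple⁺ : ∀ {x a b c : Fin n} → x ≡ a ⊎ x ≡ b ⊎ x ≡ c → x ∈ triple a b c
  ∈-triple⁺ (inj₁ refl)        = x∈p∪q⁺ (inj₁ (x∈⁅x⁆ _))
  ∈-triple⁺ (inj₂ (inj₁ refl)) = x∈p∪q⁺ (inj₂ (x∈p∪q⁺ (inj₁ (x∈⁅x⁆ _))))
  ∈-triple⁺ (inj₂ (inj₂ refl)) = x∈p∪q⁺ (inj₂ (x∈p∪q⁺ (inj₂ (x∈⁅x⁆ _))))

  x∈p⇒1≤∣p∣ : ∀ {x} {p : Subset n} → x ∈ p → 1 ≤ ∣ p ∣
  x∈p⇒1≤∣p∣ {x} {p} x∈p =
    subst (_≤ ∣ p ∣) (∣⁅x⁆∣≡1 x) (p⊆q⇒∣p∣≤∣q∣ λ y∈⁅x⁆ → subst (_∈ p) (sym (x∈⁅y⁆⇒x≡y x y∈⁅x⁆)) x∈p)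

  x∈p∧y∈p∧x≢y⇒2≤∣p∣ : ∀ {x y} {p : Subset n} → x ∈ p → y ∈ p → x ≢ y → 2 ≤ ∣ p ∣
  x∈p∧y∈p∧x≢y⇒2≤∣p∣ x∈p y∈p x≢y =
    ≤-trans (s≤s (x∈p⇒1≤∣p∣ (x∈p∧x≢y⇒x∈p-y y∈p (x≢y ∘ sym)))) (x∈p⇒∣p-x∣<∣p∣ x∈p)

  p⊆⁅x⁆⇒∣p∣≤1 : ∀ {x} {p : Subset n} → p ⊆ ⁅ x ⁆ → ∣ p ∣ ≤ 1
  p⊆⁅x⁆⇒∣p∣≤1 {x} {p} p⊆⁅x⁆ = subst (∣ p ∣ ≤_) (∣⁅x⁆∣≡1 x) (p⊆q⇒∣p∣≤∣q∣ p⊆⁅x⁆)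

  p⊆∅⇒∣p∣≡0 : ∀ {p : Subset n} → p ⊆ ∅ → ∣ p ∣ ≡ 0
  p⊆∅⇒∣p∣≡0 {p} p⊆∅ = n≤0⇒n≡0 (subst (∣ p ∣ ≤_) (∣⊥∣≡0 n) (p⊆q⇒∣p∣≤∣q∣ p⊆∅))

module _ {k n : ℕ} (v : Fin k → Fin n) where

  ∈-triple-map⁺ : ∀ {s a b c} → s ∈ triple a b c → v s ∈ triple (v a) (v b) (v c)
  ∈-triple-map⁺ = ∈-triple⁺ ∘ Sum.map (cong v) (Sum.map (cong v) (cong v)) ∘ ∈-triple⁻

  ∈-triple-map⁻ : ∀ {x a b c} → x ∈ triple (v a) (v b) (v c) → ∃[ s ] s ∈ triple a b c × v s ≡ x
  ∈-triple-map⁻ x∈ with ∈-triple⁻ x∈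
  ... | inj₁ refl        = _ , ∈-triple⁺ (inj₁ refl) , refl
  ... | inj₂ (inj₁ refl) = _ , ∈-triple⁺ (inj₂ (inj₁ refl)) , refl
  ... | inj₂ (inj₂ refl) = _ , ∈-triple⁺ (inj₂ (inj₂ refl)) , refl

module _ {k n : ℕ} {v : Fin k → Fin n} (v-injective : Injective _≡_ _≡_ v)
         {p q r p′ q′ r′ : Fin k} where

  private
    V = triple (v p) (v q) (v r) ∩ triple (v p′) (v q′) (v r′)
    I = triple p q r ∩ triple p′ q′ r′

  ∈-∩-map⁺ : ∀ {s} → s ∈ I → v s ∈ V
  ∈-∩-map⁺ s∈ with s∈pqr , s∈p′q′r′ ← x∈p∩q⁻ _ _ s∈ =
    x∈p∩q⁺ (∈-triple-map⁺ v s∈pqr , ∈-triple-map⁺ v s∈p′q′r′)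

  ∈-∩-map⁻ : ∀ {x} → x ∈ V → ∃[ s ] s ∈ I × v s ≡ x
  ∈-∩-map⁻ x∈
    with x∈pqr , x∈p′q′r′ ← x∈p∩q⁻ _ _ x∈
    with s , s∈ , refl ← ∈-triple-map⁻ v x∈pqr
    with s′ , s′∈ , vs′≡vs ← ∈-triple-map⁻ v x∈p′q′r′
    rewrite v-injective vs′≡vs
    = s , x∈p∩q⁺ (s∈ , s′∈) , refl

  -- Side conditions on the indices are `True` arguments, discharged by evaluation.
  overlapOf-many : ∀ s s′ → s ≢ s′ → {True (s ∈? I)} → {True (s′ ∈? I)} → overlapOf ∣ V ∣ ≡ many
  overlapOf-many s s′ s≢s′ {s∈} {s′∈} =
    2≤⇒overlapOf≡many (x∈p∧y∈p∧x≢y⇒2≤∣p∣ (∈-∩-map⁺ (toWitness s∈)) (∈-∩-map⁺ (toWitness s′∈))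
                                           (s≢s′ ∘ v-injective))

  overlapOf-one : ∀ s → {True (s ∈? I)} → {True (I ⊆? ⁅ s ⁆)} → overlapOf ∣ V ∣ ≡ one
  overlapOf-one s {s∈} {I⊆⁅s⁆} =
    cong overlapOf (≤-antisym (p⊆⁅x⁆⇒∣p∣≤1 V⊆⁅vs⁆) (x∈p⇒1≤∣p∣ (∈-∩-map⁺ (toWitness s∈))))
    where
      V⊆⁅vs⁆ : V ⊆ ⁅ v s ⁆
      V⊆⁅vs⁆ x∈ with s′ , s′∈ , refl ← ∈-∩-map⁻ x∈
        rewrite x∈⁅y⁆⇒x≡y s (toWitness I⊆⁅s⁆ s′∈) = x∈⁅x⁆ (v s)

  overlapOf-none : {True (I ⊆? ∅)} → overlapOf ∣ V ∣ ≡ none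
  overlapOf-none {I⊆∅} = cong overlapOf (p⊆∅⇒∣p∣≡0 V⊆∅)
    where
      V⊆∅ : V ⊆ ∅
      V⊆∅ x∈ with s , s∈ , _ ← ∈-∩-map⁻ x∈ = contradiction (toWitness I⊆∅ s∈) ∉⊥

module _ {n m : ℕ} (H : Hypergraph3 n m) where

  overlapMatrix : OverlapMatrix m
  overlapMatrix i j = overlapOf ∣ edge H i ∩ edge H j ∣

  pairwiseLight⇒oneIntersecting : ∀ {S} →
    (∀ {i j} → i ∈ S → j ∈ S → i ≢ j → Light overlapMatrix i j) → OneIntersecting H S
  pairwiseLight⇒oneIntersecting light i j i∈S j∈S i≢j = overlapOf≢many⇒≤1 _ (light i∈S j∈S i≢j)

  overlapMatrix-symmetric : ∀ i j → overlapMatrix i j ≡ overlapMatrix j i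
  overlapMatrix-symmetric i j = cong (overlapOf ∘ ∣_∣) (∩-comm (edge H i) (edge H j))

  triple-pairwise-light : ∀ {i j k} →
                          Light overlapMatrix i j → Light overlapMatrix j k → Light overlapMatrix i k →
                          ∀ {x y} → x ∈ triple i j k → y ∈ triple i j k → x ≢ y →
                          Light overlapMatrix x y
  triple-pairwise-light Lij Ljk Lik x∈ y∈ x≢y with ∈-triple⁻ x∈ | ∈-triple⁻ y∈
  ... | inj₁ refl        | inj₁ refl        = contradiction refl x≢y
  ... | inj₁ refl        | inj₂ (inj₁ refl) = Lij
  ... | inj₁ refl        | inj₂ (inj₂ refl) = Lik
  ... | inj₂ (inj₁ refl) | inj₁ refl        = light-sym overlapMatrix-symmetric Lij
  ... | inj₂ (inj₁ refl) | inj₂ (inj₁ refl) = contradiction refl x≢y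
  ... | inj₂ (inj₁ refl) | inj₂ (inj₂ refl) = Ljk
  ... | inj₂ (inj₂ refl) | inj₁ refl        = light-sym overlapMatrix-symmetric Lik
  ... | inj₂ (inj₂ refl) | inj₂ (inj₁ refl) = light-sym overlapMatrix-symmetric Ljk
  ... | inj₂ (inj₂ refl) | inj₂ (inj₂ refl) = contradiction refl x≢y

  overlapMatrix-admissible :
    ((i j k : Fin m) → i ≢ j → j ≢ k → i ≢ k → ¬ OneIntersecting H (triple i j k)) →
    Admissible overlapMatrix
  overlapMatrix-admissible no-1-intersecting-triple = record
    { symmetric         = overlapMatrix-symmetric
    ; diagonal          = λ i → cong overlapOf (trans (cong ∣_∣ (∩-idem (edge H i))) (uniform H i))
    ; no-light-triangle = λ i≢j j≢k i≢k Lij Ljk Lik →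
        no-1-intersecting-triple _ _ _ i≢j j≢k i≢k
          (pairwiseLight⇒oneIntersecting (triple-pairwise-light Lij Ljk Lik))
    }

  copyEdge : ∀ {S} → ContainsT36Outside H S → Fin 4 → Fin m
  copyEdge (_ , _ , f) t = proj₁ (f t)

  copy⇒tightPath : ∀ {S} (copy : ContainsT36Outside H S) →
                   TightPath overlapMatrix (copyEdge copy 0F) (copyEdge copy 1F)
                                           (copyEdge copy 2F) (copyEdge copy 3F)
  copy⇒tightPath (v , v-injective , f) = record
    { ab = trans (window-overlap 0F 1F) (overlapOf-many v-injective 1F 2F λ ())
    ; bc = trans (window-overlap 1F 2F) (overlapOf-many v-injective 2F 3F λ ())
    ; cd = trans (window-overlap 2F 3F) (overlapOf-many v-injective 3F 4F λ ())
    ; ac = trans (window-overlap 0F 2F) (overlapOf-one v-injective 2F)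
    ; bd = trans (window-overlap 1F 3F) (overlapOf-one v-injective 3F)
    ; ad = trans (window-overlap 0F 3F) (overlapOf-none v-injective)
    }
    where
      window : Fin 4 → Subset n
      window t = triple (v (inject₁ (inject₁ t))) (v (suc (inject₁ t))) (v (suc (suc t)))
      window-overlap : ∀ s t →
                       overlapMatrix (proj₁ (f s)) (proj₁ (f t)) ≡ overlapOf ∣ window s ∩ window t ∣
      window-overlap s t =
        cong₂ (λ X Y → overlapOf ∣ X ∩ Y ∣) (proj₂ (proj₂ (f s))) (proj₂ (proj₂ (f t)))

  transversal⇒T36-free : ∀ {S} → Transversal overlapMatrix S → ¬ ContainsT36Outside H S
  transversal⇒T36-free {S} T copy@(_ , _ , f) = outside (Transversal.meets T (copy⇒tightPath copy))
    where
      outside : ¬ (copyEdge copy 0F ∈ S ⊎ copyEdge copy 1F ∈ S ⊎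
                   copyEdge copy 2F ∈ S ⊎ copyEdge copy 3F ∈ S)
      outside (inj₁ e₀∈S)               = proj₁ (proj₂ (f 0F)) e₀∈S
      outside (inj₂ (inj₁ e₁∈S))        = proj₁ (proj₂ (f 1F)) e₁∈S
      outside (inj₂ (inj₂ (inj₁ e₂∈S))) = proj₁ (proj₂ (f 2F)) e₂∈S
      outside (inj₂ (inj₂ (inj₂ e₃∈S))) = proj₁ (proj₂ (f 3F)) e₃∈S

lemmaA2 : (n : ℕ) (H : Hypergraph3 n 7) →
    ((i j k : Fin 7) → i ≢ j → j ≢ k → i ≢ k →
      ¬ OneIntersecting H (⁅ i ⁆ ∪ (⁅ j ⁆ ∪ ⁅ k ⁆))) →
    Σ (Subset 7) λ S → OneIntersecting H S × ¬ ContainsT36Outside H S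
lemmaA2 n H no-1-intersecting-triple =
  let S , T = transversal-exists (overlapMatrix-admissible H no-1-intersecting-triple)
  in S , pairwiseLight⇒oneIntersecting H (Transversal.pairwise-light T) , transversal⇒T36-free H T
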